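{- On any UFTRA instance, let $(y,x)$ and the dual values $\alpha_j^q$ be produced by the Primal-Dual Algorithm described below. Set $\alpha_j=\alpha_j^{r_j}$ for every client $j$, and let $SOL_D=\sum_{j\in\mathcal{C}}r_j\alpha_j$. Then $SOL_D\ge \sum_i f_iy_i+\sum_{i,j}c_{ij}x_{ij}$.
   Context: UFTRA: we are given sites $\mathcal{F}$ with opening costs $f_i\ge0$, and clients $\mathcal{C}$ with requirements $r_j\in\mathbb{Z}_{\ge1}$. Connection costs are $c_{ij}\ge0$. A solution consists of nonnegative integers $y_i$ (the number of facilities opened at site $i$) and $x_{ij}$, with $\sum_ix_{ij}\ge r_j$ and $x_{ij}\le y_i$. Primal-Dual Algorithm. Initially $y_i=x_{ij}=0$, $p_j=1$ and $\mathcal{U}=\mathcal{C}$. Client $j$ has ports $j^{(1)},\dots,j^{(r_j)}$, connected in increasing order; $p_j$ is the next port, and $\phi(j^{(q)})$ is the site a connected port is assigned to. For $j\notin\mathcal{U}$, let $M_j=\max_q c_{\phi(j^{(q)})j}$. A time $t$ increases continuously from $0$ while $\mathcal{U}\ne\emptyset$; simultaneous events are processed in arbitrary order, and events may repeat. Event 1: some $i$ and $j\in\mathcal{U}$ satisfy $t=c_{ij}$ and $x_{ij}<y_i$. Action 1: set $\phi(j^{(p_j)})=i$, $x_{ij}\leftarrow x_{ij}+1$, and $\alpha_j^{p_j}=t$; if $p_j=r_j$, remove $j$ from $\mathcal{U}$, otherwise increase $p_j$ by 1. Event 2: some $i$ satisfies $\sum_{j\in\mathcal{U}}\max(0,t-c_{ij})+\sum_{j\in\mathcal{C}\setminus\mathcal{U}}\max(0,M_j-c_{ij})=f_i$.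 Action 2: set $y_i\leftarrow y_i+1$. For every $j\in\mathcal{C}\setminus\mathcal{U}$ with $M_j>c_{ij}$, take a port $j^{(q)}$ attaining $M_j$, decrease $x_{\phi(j^{(q)})j}$ by 1, increase $x_{ij}$ by 1, and set $\phi(j^{(q)})=i$. Then perform Action 1 with site $i$ for every $j\in\mathcal{U}$ with $t\ge c_{ij}$.
   Formalization: The opening costs $f_i$ and connection costs $c_{ij}$ are rational, and so are the time $t$ and the dual values $\alpha_j^q$. -}

module Defs where

open import Data.Nat as ℕ using (ℕ; zero; suc)
open import Data.Integer using (+_)
open import Data.Rational using (ℚ; 0ℚ; _+_; _-_; _*_; _≤_; _<_; _⊔_; _/_)
open import Data.Fin using (Fin)
open import Data.Fin.Properties using () renaming (_≟_ to _≟ᶠ_)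
open import Data.List using (List; []; _∷_; map; foldr; allFin)
open import Data.Bool using (Bool; true; false; if_then_else_)
open import Data.Maybe using (Maybe; just; nothing; maybe)
open import Data.Product using (Σ; ∃; _×_; _,_)
open import Data.Sum using (_⊎_)
open import Relation.Nullary using (¬_; yes; no)
open import Relation.Binary.PropositionalEquality using (_≡_)
open import Relation.Binary.Construct.Closure.ReflexiveTransitive using (Star)

ℕ→ℚ : ℕ → ℚ
ℕ→ℚ k = + k / 1

Σℚ : (k : ℕ) → (Fin k → ℚ) → ℚ
Σℚ k g = foldr _+_ 0ℚ (map g (allFin k))

maxℚ : List ℚ → ℚ
maxℚ = foldr _⊔_ 0ℚ

ports : ℕ → List ℕ
ports zero    = []
ports (suc k) = ports k Data.List.++ (suc k ∷ [])

updFin : {k : ℕ} {A : Set} → (Fin k → A) → Fin k → A → Fin k → A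
updFin g a v b with a ≟ᶠ b
... | yes _ = v
... | no  _ = g b

updℕ : {A : Set} → (ℕ → A) → ℕ → A → ℕ → A
updℕ g a v b with a ℕ.≟ b
... | yes _ = v
... | no  _ = g b

-- The Primal-Dual algorithm for a UFTRA instance with m sites, n clients,
-- opening costs f, connection costs c and requirements r.

module PrimalDual (m n : ℕ) (f : Fin m → ℚ) (c : Fin m → Fin n → ℚ)
                  (r : Fin n → ℕ) where

  -- State of the algorithm.  Ports of client j are numbered 1..r j.
  record State : Set where
    field
      t   : ℚ
      y   : Fin m → ℕ
      x   : Fin m → Fin n → ℕ
      p   : Fin n → ℕ
      inU : Fin n → Bool             -- j ∈ U  iff  inU j ≡ true
      φ   : Fin n → ℕ → Maybe (Fin m) -- φ(j^(q)) (nothing = not connected)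
      α   : Fin n → ℕ → ℚ            -- α_j^q (meaningful once set)
  open State public

  initial : State
  initial = record
    { t = 0ℚ ; y = λ _ → 0 ; x = λ _ _ → 0 ; p = λ _ → 1
    ; inU = λ _ → true ; φ = λ _ _ → nothing ; α = λ _ _ → 0ℚ }

  portCost : State → Fin n → ℕ → ℚ
  portCost s j q = maybe (λ i → c i j) 0ℚ (φ s j q)

  -- M_j = max_q c_{φ(j^(q)) j}   (used for j ∉ U, where all ports are connected)
  M : State → Fin n → ℚ
  M s j = maxℚ (map (portCost s j) (ports (r j)))

  Attains : State → Fin n → ℕ → Fin m → Set
  Attains s j q k = (1 ℕ.≤ q) × (q ℕ.≤ r j) × (φ s j q ≡ just k) × (c k j ≡ M s j)

  -- left-hand side of Event 2 for site i
  contrib : State → Fin m → Fin n → ℚ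
  contrib s i j = if inU s j then 0ℚ ⊔ (t s - c i j) else 0ℚ ⊔ (M s j - c i j)

  bid : State → Fin m → ℚ
  bid s i = Σℚ n (contrib s i)

  action1 : Fin m → Fin n → State → State
  action1 i j s = record s
    { x   = updFin (x s) i (updFin (x s i) j (suc (x s i j)))
    ; φ   = updFin (φ s) j (updℕ (φ s j) (p s j) (just i))
    ; α   = updFin (α s) j (updℕ (α s j) (p s j) (t s))
    ; inU = updFin (inU s) j (if ⌊ p s j ℕ.≟ r j ⌋ then false else inU s j)
    ; p   = updFin (p s) j (if ⌊ p s j ℕ.≟ r j ⌋ then p s j else suc (p s j))
    }
    where open import Relation.Nullary.Decidable using (⌊_⌋)

  -- moving port j^(q) from site k to site i (first part of Action 2)
  move : Fin m → Fin n → ℕ → Fin m → State → State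
  move i j q k s = record s
    { x = λ i' j' → if ⌊ j' ≟ᶠ j ⌋
                      then ((if ⌊ i' ≟ᶠ i ⌋ then suc (x s i' j') else x s i' j')
                             ℕ.∸ (if ⌊ i' ≟ᶠ k ⌋ then 1 else 0))
                      else x s i' j'
    ; φ = updFin (φ s) j (updℕ (φ s j) q (just i))
    }
    where open import Relation.Nullary.Decidable using (⌊_⌋)

  Reassignable : State → Fin m → Fin n → Set
  Reassignable s i j = (inU s j ≡ false) × (c i j < M s j)

  data Reassign (i : Fin m) : List (Fin n) → State → State → Set where
    done : ∀ {s} → Reassign i [] s s
    skip : ∀ {j js s s'} → ¬ Reassignable s i j →
           Reassign i js s s' → Reassign i (j ∷ js) s s'
    mv   : ∀ {j js s s'} q k → Reassignable s i j → Attains s j q k →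
           Reassign i js (move i j q k s) s' → Reassign i (j ∷ js) s s'

  connectAll : Fin m → List (Fin n) → State → State
  connectAll i []       s = s
  connectAll i (j ∷ js) s =
    connectAll i js (if inU s j ∧ ⌊ c i j Data.Rational.≤? t s ⌋ then action1 i j s else s)
    where open import Relation.Nullary.Decidable using (⌊_⌋)
          open import Data.Bool using (_∧_)
          import Data.Rational

  openAt : Fin m → State → State
  openAt i s = record s { y = updFin (y s) i (suc (y s i)) }

  Event1 : State → Fin m → Fin n → Set
  Event1 s i j = (inU s j ≡ true) × (t s ≡ c i j) × (x s i j ℕ.< y s i)

  Event2 : State → Fin m → Set
  Event2 s i = bid s i ≡ f i

  Enabled : State → Set
  Enabled s = (Σ (Fin m) λ i → Σ (Fin n) λ j → Event1 s i j) ⊎ (Σ (Fin m) λ i → Event2 s i)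

  Unfinished : State → Set
  Unfinished s = Σ (Fin n) λ j → inU s j ≡ true

  data Step : State → State → Set where
    ev1  : ∀ {s} i j → Unfinished s → Event1 s i j → Step s (action1 i j s)
    ev2  : ∀ {s s'} i → Unfinished s → Event2 s i →
           Reassign i (allFin n) (openAt i s) s' →
           Step s (connectAll i (allFin n) s')
    tick : ∀ {s} (t' : ℚ) → Unfinished s → t s < t' →
           (∀ u → t s ≤ u → u < t' → ¬ Enabled (record s { t = u })) →
           Step s (record s { t = t' })

  Produced : State → Set
  Produced s = Star Step initial s × (∀ j → inU s j ≡ false)

  SOL-D : State → ℚ
  SOL-D s = Σℚ n (λ j → ℕ→ℚ (r j) * α s j (r j))

  primalCost : State → ℚ
  primalCost s = Σℚ m (λ i → f i * ℕ→ℚ (y s i))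
               + Σℚ m (λ i → Σℚ n (λ j → c i j * ℕ→ℚ (x s i j)))

module Submission where

-- Potential argument.  Every connected port q of client j has "paid" its dual
-- value α_j^q.  The surplus of a state is the total dual value paid minus the
-- primal cost Σ f_i y_i + Σ c_ij x_ij, and every step of the algorithm keeps it
-- exactly 0: Event 1 connects a port at time t = c_ij; Event 2 costs f_i, which
-- equals the bid of site i, and the bid is earned back in full -- reassigning a
-- port from k to i earns c_kj - c_ij = M_j - c_ij, connecting a client of U
-- earns t - c_ij -- and clients that do neither offer 0.  The surplus step for
-- a reassignment needs x_kj ≥ 1, so along the run we also maintain per-client
-- bookkeeping (ports are filled in order, α ≤ t, x_ij is at least the number
-- of ports of j at i).  Finally, for a finished client every connected port
-- paid at most α_j = α_j^{r_j}, so the dual value paid is at most SOL_D.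

open import Defs
open import Algebra.Bundles using (CommutativeMonoid)
import Algebra.Properties.CommutativeMonoid.Sum as MonoidSum
import Algebra.Properties.CommutativeSemigroup as CommSemigroupProperties
open import Data.Bool using (Bool; true; false; if_then_else_; _∧_)
open import Data.Empty using (⊥-elim)
open import Data.Fin using (Fin; zero; suc; toℕ; fromℕ<)
open import Data.Fin.Properties using (toℕ-injective; toℕ-fromℕ<; suc-injective) renaming (_≟_ to _≟ᶠ_)
open import Data.Integer using () renaming (+_ to ℤ+_)
open import Data.Integer.Properties using (+◃n≡+n)
open import Data.List using (List; []; _∷_; map; foldr; allFin; tabulate)
open import Data.List.Properties using (map-tabulate)
import Data.List.Relation.Unary.All as All
open All using (All; []; _∷_)
open import Data.List.Relation.Unary.AllPairs using ([]; _∷_)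
open import Data.List.Relation.Unary.Unique.Propositional using (Unique)
open import Data.List.Relation.Unary.Unique.Propositional.Properties using (allFin⁺)
open import Data.Maybe using (Maybe; just; nothing; maybe)
import Data.Nat
open import Data.Nat as ℕ using (ℕ; zero; suc; z≤n; s≤s)
import Data.Nat.Properties as ℕP
open import Data.Nat.Coprimality using (1-coprimeTo) renaming (sym to coprime-sym)
open import Data.Product using (_×_; _,_; proj₁; proj₂)
open import Data.Rational using (ℚ; 0ℚ; 1ℚ; _+_; _-_; _*_; _⊔_; _≤_; _≤?_; -_)
import Data.Rational.Properties as ℚP
open import Algebra.Properties.Group ℚP.+-0-group using (∙-cancelˡ; x∙y⁻¹≈ε⇒x≈y)
open import Data.Rational.Solver using (module +-*-Solver)
open import Data.Vec.Functional using (Vector)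
open import Function using (_∘_; id)
open import Relation.Binary.Construct.Closure.ReflexiveTransitive using (Star; ε; _◅_)
open import Relation.Binary.PropositionalEquality
  using (_≡_; _≢_; refl; sym; trans; cong; cong₂; subst; subst₂; module ≡-Reasoning)
import Relation.Binary.Reasoning.Setoid as SetoidReasoning
open import Relation.Nullary using (¬_; Dec; yes; no)
open import Relation.Nullary.Decidable using (⌊_⌋)

open +-*-Solver using (solve; _:+_; _:-_; _:*_; _:=_; con)

ℕ→ℚ-suc : ∀ k → ℕ→ℚ (suc k) ≡ ℕ→ℚ k + 1ℚ
ℕ→ℚ-suc k rewrite ℚP.normalize-coprime {k} {0} (coprime-sym (1-coprimeTo k))
                | +◃n≡+n (k ℕ.* 1) | ℕP.*-identityʳ k
  = cong (λ a → ℤ+ a Data.Rational./ 1) (ℕP.+-comm 1 k)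

*-suc : ∀ a k → a * ℕ→ℚ (suc k) ≡ a * ℕ→ℚ k + a
*-suc a k = trans (cong (a *_) (ℕ→ℚ-suc k))
                  (trans (ℚP.*-distribˡ-+ a (ℕ→ℚ k) 1ℚ) (cong ((a * ℕ→ℚ k) +_) (ℚP.*-identityʳ a)))

posPart-≥ : ∀ {a b} → a ≤ b → 0ℚ ⊔ (b - a) ≡ b - a
posPart-≥ {a} {b} a≤b = ℚP.p≤q⇒p⊔q≡q (subst (_≤ b - a) (ℚP.+-inverseʳ a) (ℚP.+-monoˡ-≤ (- a) a≤b))

posPart-≤ : ∀ {a b} → b ≤ a → 0ℚ ⊔ (b - a) ≡ 0ℚ
posPart-≤ {a} {b} b≤a = ℚP.p≥q⇒p⊔q≡p (subst (b - a ≤_) (ℚP.+-inverseʳ a) (ℚP.+-monoˡ-≤ (- a) b≤a))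

port : ∀ {R} → Fin R → ℕ
port q = suc (toℕ q)

portIndex : ∀ {R p} → 1 ℕ.≤ p → p ℕ.≤ R → Fin R
portIndex {p = suc p'} _ p≤R = fromℕ< p≤R

port-portIndex : ∀ {R p} (1≤p : 1 ℕ.≤ p) (p≤R : p ℕ.≤ R) → port (portIndex 1≤p p≤R) ≡ p
port-portIndex {p = suc p'} _ p≤R = cong suc (toℕ-fromℕ< p≤R)

port-injective : ∀ {R} {a b : Fin R} → port a ≡ port b → a ≡ b
port-injective = toℕ-injective ∘ ℕP.suc-injective

module MonoidSums {c ℓ} (M : CommutativeMonoid c ℓ) where
  open CommutativeMonoid M using (_≈_; _∙_; ∙-cong; ∙-congˡ; commutativeSemigroup; setoid)
    renaming (Carrier to A)
  open MonoidSum M using (sum; sum-cong-≋; sum-cong-≗; sum-replicate-zero) public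
  open CommSemigroupProperties commutativeSemigroup using (x∙yz≈y∙xz)
  open SetoidReasoning setoid

  -- Changing a single summand: stated without subtraction, so it holds in
  -- every commutative monoid (used for ℕ counts and ℚ costs alike).
  sum-update : ∀ {k} (g' g : Vector A k) (a : Fin k) →
               (∀ b → b ≢ a → g' b ≈ g b) → g a ∙ sum g' ≈ g' a ∙ sum g
  sum-update {suc k} g' g zero agree = begin
    g zero ∙ (g' zero ∙ sum (g' ∘ suc)) ≈⟨ ∙-congˡ (∙-congˡ (sum-cong-≋ λ b → agree (suc b) λ ())) ⟩
    g zero ∙ (g' zero ∙ sum (g ∘ suc))  ≈⟨ x∙yz≈y∙xz _ _ _ ⟩
    g' zero ∙ (g zero ∙ sum (g ∘ suc))  ∎
  sum-update {suc k} g' g (suc a) agree = begin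
    g (suc a) ∙ (g' zero ∙ sum (g' ∘ suc))  ≈⟨ x∙yz≈y∙xz _ _ _ ⟩
    g' zero ∙ (g (suc a) ∙ sum (g' ∘ suc))  ≈⟨ ∙-cong (agree zero λ ()) tail-update ⟩
    g zero ∙ (g' (suc a) ∙ sum (g ∘ suc))   ≈⟨ x∙yz≈y∙xz _ _ _ ⟩
    g' (suc a) ∙ (g zero ∙ sum (g ∘ suc))   ∎
    where
    tail-update : g (suc a) ∙ sum (g' ∘ suc) ≈ g' (suc a) ∙ sum (g ∘ suc)
    tail-update = sum-update (g' ∘ suc) (g ∘ suc) a λ b b≢a → agree (suc b) (b≢a ∘ suc-injective)

  portSum : (ℕ → A) → ℕ → A
  portSum h R = sum {R} λ q → h (port q)

  portSum-update : ∀ R (h' h : ℕ → A) {p} → 1 ℕ.≤ p → p ℕ.≤ R →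
                   (∀ q → q ≢ p → h' q ≈ h q) → h p ∙ portSum h' R ≈ h' p ∙ portSum h R
  portSum-update R h' h 1≤p p≤R agree =
    subst (λ q → h q ∙ portSum h' R ≈ h' q ∙ portSum h R) (port-portIndex 1≤p p≤R)
      (sum-update (λ q → h' (port q)) (λ q → h (port q)) (portIndex 1≤p p≤R)
        λ b b≢a → agree (port b) λ e → b≢a (port-injective (trans e (sym (port-portIndex 1≤p p≤R)))))

open MonoidSums ℚP.+-0-commutativeMonoid
module Count = MonoidSums ℕP.+-0-commutativeMonoid

sum-shift : ∀ {k} (g' g : Vector ℚ k) a δ → (∀ b → b ≢ a → g' b ≡ g b) →
            g' a ≡ g a + δ → sum g' ≡ sum g + δ
sum-shift g' g a δ agree g'a = ∙-cancelˡ (g a) (sum g') (sum g + δ) (begin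
  g a + sum g'       ≡⟨ sum-update g' g a agree ⟩
  g' a + sum g       ≡⟨ cong (_+ sum g) g'a ⟩
  (g a + δ) + sum g  ≡⟨ solve 3 (λ x y z → (x :+ z) :+ y := x :+ (y :+ z)) refl (g a) (sum g) δ ⟩
  g a + (sum g + δ)  ∎)
  where open ≡-Reasoning

sum-mono : ∀ {k} {g h : Vector ℚ k} → (∀ a → g a ≤ h a) → sum g ≤ sum h
sum-mono {zero}  g≤h = ℚP.≤-refl
sum-mono {suc k} g≤h = ℚP.+-mono-≤ (g≤h zero) (sum-mono (g≤h ∘ suc))

sum-bound : ∀ {k} (g : Vector ℚ k) A → (∀ a → g a ≤ A) → sum g ≤ ℕ→ℚ k * A
sum-bound {zero}  g A g≤A = ℚP.≤-reflexive (sym (ℚP.*-zeroˡ A))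
sum-bound {suc k} g A g≤A = begin
  g zero + sum (g ∘ suc)  ≤⟨ ℚP.+-mono-≤ (g≤A zero) (sum-bound (g ∘ suc) A (g≤A ∘ suc)) ⟩
  A + ℕ→ℚ k * A           ≡⟨ solve 2 (λ a x → a :+ x :* a := (x :+ con 1ℚ) :* a) refl A (ℕ→ℚ k) ⟩
  (ℕ→ℚ k + 1ℚ) * A        ≡⟨ cong (_* A) (sym (ℕ→ℚ-suc k)) ⟩
  ℕ→ℚ (suc k) * A         ∎
  where open ℚP.≤-Reasoning

listSum : {B : Set} → List B → (B → ℚ) → ℚ
listSum L g = foldr _+_ 0ℚ (map g L)

listSum-cong : ∀ {B : Set} {L : List B} {g h : B → ℚ} → All (λ b → g b ≡ h b) L →
               listSum L g ≡ listSum L h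
listSum-cong []         = refl
listSum-cong (e ∷ rest) = cong₂ _+_ e (listSum-cong rest)

listSum-+ : ∀ {B : Set} (L : List B) (g h : B → ℚ) →
            listSum L (λ b → g b + h b) ≡ listSum L g + listSum L h
listSum-+ []      g h = sym (ℚP.+-identityʳ 0ℚ)
listSum-+ (b ∷ L) g h rewrite listSum-+ L g h =
  solve 4 (λ x y z w → (x :+ y) :+ (z :+ w) := (x :+ z) :+ (y :+ w)) refl (g b) (h b) (listSum L g) (listSum L h)

Σℚ≡sum : ∀ k (g : Fin k → ℚ) → Σℚ k g ≡ sum g
Σℚ≡sum zero    g = refl
Σℚ≡sum (suc k) g = cong (g zero +_) (trans (cong (foldr _+_ 0ℚ) tail≡) (Σℚ≡sum k (g ∘ suc)))
  where
  tail≡ : map g (tabulate suc) ≡ map (g ∘ suc) (allFin k)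
  tail≡ = trans (map-tabulate suc g) (sym (map-tabulate id (g ∘ suc)))

updFin-same : ∀ {k} {B : Set} (g : Fin k → B) a v → updFin g a v a ≡ v
updFin-same g a v with a ≟ᶠ a
... | yes _   = refl
... | no  a≢a = ⊥-elim (a≢a refl)

updFin-other : ∀ {k} {B : Set} (g : Fin k → B) a v b → a ≢ b → updFin g a v b ≡ g b
updFin-other g a v b a≢b with a ≟ᶠ b
... | yes a≡b = ⊥-elim (a≢b a≡b)
... | no  _   = refl

updℕ-same : ∀ {B : Set} (g : ℕ → B) a v → updℕ g a v a ≡ v
updℕ-same g a v with a ℕ.≟ a
... | yes _   = refl
... | no  a≢a = ⊥-elim (a≢a refl)

updℕ-other : ∀ {B : Set} (g : ℕ → B) a v b → a ≢ b → updℕ g a v b ≡ g b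
updℕ-other g a v b a≢b with a ℕ.≟ b
... | yes a≡b = ⊥-elim (a≢b a≡b)
... | no  _   = refl

assignedTo : ∀ {m} → Maybe (Fin m) → Fin m → ℕ
assignedTo nothing  i = 0
assignedTo (just k) i = if ⌊ i ≟ᶠ k ⌋ then 1 else 0

assignedTo-same : ∀ {m} (i : Fin m) → assignedTo (just i) i ≡ 1
assignedTo-same i with i ≟ᶠ i
... | yes _   = refl
... | no  i≢i = ⊥-elim (i≢i refl)

if-yes : ∀ {P B : Set} (d : Dec P) {a b : B} → P → (if ⌊ d ⌋ then a else b) ≡ a
if-yes (yes _) _  = refl
if-yes (no ¬P) pf = ⊥-elim (¬P pf)

if-no : ∀ {P B : Set} (d : Dec P) {a b : B} → ¬ P → (if ⌊ d ⌋ then a else b) ≡ b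
if-no (yes pf) ¬P = ⊥-elim (¬P pf)
if-no (no _)   _  = refl

if-suc : ∀ (b : Bool) a → (if b then suc a else a) ≡ (if b then 1 else 0) ℕ.+ a
if-suc true  a = refl
if-suc false a = refl

if-split : ∀ (b : Bool) (u v : ℚ) → (if b then u else v) ≡ (if b then u else 0ℚ) + (if b then 0ℚ else v)
if-split true  u v = sym (ℚP.+-identityʳ u)
if-split false u v = sym (ℚP.+-identityˡ v)

bump : ∀ {m n} → (Fin m → Fin n → ℕ) → Fin m → Fin n → Fin m → Fin n → ℕ
bump u a b = updFin u a (updFin (u a) b (suc (u a b)))

bump-same : ∀ {m n} (u : Fin m → Fin n → ℕ) a b → bump u a b a b ≡ suc (u a b)
bump-same u a b rewrite updFin-same u a (updFin (u a) b (suc (u a b))) = updFin-same (u a) b _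

bump-row-other : ∀ {m n} (u : Fin m → Fin n → ℕ) a b {a' b'} → a' ≢ a → bump u a b a' b' ≡ u a' b'
bump-row-other u a b {a'} {b'} a'≢a = cong (λ g → g b') (updFin-other u a _ a' (a'≢a ∘ sym))

bump-off-column : ∀ {m n} (u : Fin m → Fin n → ℕ) a b {a' b'} → b' ≢ b → bump u a b a' b' ≡ u a' b'
bump-off-column u a b {a'} {b'} b'≢b with a ≟ᶠ a'
... | yes refl = updFin-other (u a) b _ b' (b'≢b ∘ sym)
... | no  _    = refl

bump-column : ∀ {m n} (u : Fin m → Fin n → ℕ) a b a' → bump u a b a' b ≡ assignedTo (just a) a' ℕ.+ u a' b
bump-column u a b a' with a' ≟ᶠ a
... | yes refl = bump-same u a b
... | no  a'≢a = bump-row-other u a b a'≢a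

weighted-suc : ∀ {k} (w : Vector ℚ k) (u u' : Vector ℕ k) a →
               (∀ b → b ≢ a → u' b ≡ u b) → u' a ≡ suc (u a) →
               sum (λ b → w b * ℕ→ℚ (u' b)) ≡ sum (λ b → w b * ℕ→ℚ (u b)) + w a
weighted-suc w u u' a agree u'a = sum-shift _ _ a (w a)
  (λ b b≢a → cong (λ v → w b * ℕ→ℚ v) (agree b b≢a))
  (trans (cong (λ v → w a * ℕ→ℚ v) u'a) (*-suc (w a) (u a)))

cost : ∀ {m n} → (Fin m → Fin n → ℚ) → (Fin m → Fin n → ℕ) → ℚ
cost W u = sum λ a → sum λ b → W a b * ℕ→ℚ (u a b)

cost-cong : ∀ {m n} (W : Fin m → Fin n → ℚ) {u u'} → (∀ a b → u a b ≡ u' a b) → cost W u ≡ cost W u'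
cost-cong W agree = sum-cong-≗ λ a → sum-cong-≗ λ b → cong (λ v → W a b * ℕ→ℚ v) (agree a b)

cost-bump : ∀ {m n} (W : Fin m → Fin n → ℚ) u a b → cost W (bump u a b) ≡ cost W u + W a b
cost-bump W u a b = sum-shift _ _ a (W a b)
  (λ a' a'≢a → sum-cong-≗ λ b' → cong (λ v → W a' b' * ℕ→ℚ v) (bump-row-other u a b a'≢a))
  (weighted-suc (W a) (u a) (bump u a b a) b (λ b' b'≢b → bump-off-column u a b b'≢b) (bump-same u a b))

portSum-term : ∀ R (h : ℕ → ℕ) {p} → 1 ℕ.≤ p → p ℕ.≤ R → h p ℕ.≤ Count.portSum h R
portSum-term R h {p} 1≤p p≤R = subst (h p ℕ.≤_) without-p (ℕP.m≤m+n (h p) _)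
  where
  without-p : h p ℕ.+ Count.portSum (updℕ h p 0) R ≡ Count.portSum h R
  without-p = trans (Count.portSum-update R (updℕ h p 0) h 1≤p p≤R λ q q≢p → updℕ-other h p 0 q (q≢p ∘ sym))
                    (cong (ℕ._+ Count.portSum h R) (updℕ-same h p 0))

bound-transfer : ∀ {d d' l l' x x'} → d' ℕ.+ l' ≡ d ℕ.+ l → d' ℕ.+ x' ≡ d ℕ.+ x →
                 l ℕ.≤ x → l' ℕ.≤ x'
bound-transfer {d} {d'} el ex l≤x =
  ℕP.+-cancelˡ-≤ d' _ _ (subst₂ ℕ._≤_ (sym el) (sym ex) (ℕP.+-monoʳ-≤ d l≤x))

flag-clash : ∀ {A : Set} {b : Bool} → b ≡ true → b ≡ false → A
flag-clash refl ()

module Analysis (m n : ℕ) (f : Fin m → ℚ) (c : Fin m → Fin n → ℚ) (r : Fin n → ℕ) where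
  open PrimalDual m n f c r

  paid : Maybe (Fin m) → ℚ → ℚ
  paid nothing  _ = 0ℚ
  paid (just _) a = a

  portDual : State → Fin n → ℕ → ℚ
  portDual s j q = paid (φ s j q) (α s j q)

  dualPaid : State → ℚ
  dualPaid s = sum λ j → portSum (portDual s j) (r j)

  openingCost : State → ℚ
  openingCost s = sum λ i → f i * ℕ→ℚ (y s i)

  connectionCost : State → ℚ
  connectionCost s = cost c (x s)

  surplus : State → ℚ
  surplus s = dualPaid s - (openingCost s + connectionCost s)

  load : State → Fin m → Fin n → ℕ
  load s i j = Count.portSum (λ q → assignedTo (φ s j q) i) (r j)

  record ClientInv (s : State) (j : Fin n) : Set where
    field
      dual≤time  : ∀ q → portDual s j q ≤ t s
      nextPort   : inU s j ≡ true → 1 ℕ.≤ p s j × p s j ℕ.≤ r j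
      freePorts  : inU s j ≡ true → ∀ q → p s j ℕ.≤ q → φ s j q ≡ nothing
      dual≤final : inU s j ≡ false → ∀ (q : Fin (r j)) → portDual s j (port q) ≤ α s j (r j)
      load≤x     : ∀ i → load s i j ℕ.≤ x s i j
  open ClientInv

  Inv : State → Set
  Inv s = ∀ j → ClientInv s j

  transport : ∀ {s s' j} → t s ≤ t s' → φ s' j ≡ φ s j → α s' j ≡ α s j →
              inU s' j ≡ inU s j → p s' j ≡ p s j → (∀ i → x s' i j ≡ x s i j) →
              ClientInv s j → ClientInv s' j
  transport {s} {s'} {j} t≤t' eφ eα eU ep ex I = record
    { dual≤time  = λ q → ℚP.≤-trans (ℚP.≤-reflexive (portDual≡ q)) (ℚP.≤-trans (dual≤time I q) t≤t')
    ; nextPort   = λ e → subst (λ v → 1 ℕ.≤ v × v ℕ.≤ r j) (sym ep) (nextPort I (trans (sym eU) e))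
    ; freePorts  = λ e q p≤q → trans (cong (λ g → g q) eφ)
                                     (freePorts I (trans (sym eU) e) q (subst (ℕ._≤ q) ep p≤q))
    ; dual≤final = λ e q → subst₂ _≤_ (sym (portDual≡ (port q))) (cong (λ g → g (r j)) (sym eα))
                                       (dual≤final I (trans (sym eU) e) q)
    ; load≤x     = λ i → subst₂ ℕ._≤_ (sym (load≡ i)) (sym (ex i)) (load≤x I i)
    }
    where
    portDual≡ : ∀ q → portDual s' j q ≡ portDual s j q
    portDual≡ q = cong₂ (λ g h → paid (g q) (h q)) eφ eα
    load≡ : ∀ i → load s' i j ≡ load s i j
    load≡ i = cong (λ g → Count.portSum (λ q → assignedTo (g q) i) (r j)) eφ

  load-update : ∀ {s s' j q} o → φ s' j ≡ updℕ (φ s j) q o → 1 ℕ.≤ q → q ℕ.≤ r j → ∀ i' →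
                assignedTo (φ s j q) i' ℕ.+ load s' i' j ≡ assignedTo o i' ℕ.+ load s i' j
  load-update {s} {s'} {j} {q} o eφ 1≤q q≤r i' = begin
    assignedTo (φ s j q) i' ℕ.+ load s' i' j   ≡⟨ Count.portSum-update (r j) _ _ 1≤q q≤r changed-only-at-q ⟩
    assignedTo (φ s' j q) i' ℕ.+ load s i' j   ≡⟨ cong (λ v → assignedTo v i' ℕ.+ load s i' j) now-o ⟩
    assignedTo o i' ℕ.+ load s i' j            ∎
    where
    open ≡-Reasoning
    now-o : φ s' j q ≡ o
    now-o = trans (cong (λ g → g q) eφ) (updℕ-same (φ s j) q o)
    changed-only-at-q : ∀ q' → q' ≢ q → assignedTo (φ s' j q') i' ≡ assignedTo (φ s j q') i'
    changed-only-at-q q' q'≢q = cong (λ v → assignedTo v i')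
      (trans (cong (λ g → g q') eφ) (updℕ-other (φ s j) q o q' (q'≢q ∘ sym)))

  module Connection (i : Fin m) (j : Fin n) (s : State) where
    s₁ : State
    s₁ = action1 i j s

    φ-other : ∀ {j'} → j' ≢ j → φ s₁ j' ≡ φ s j'
    φ-other {j'} j'≢j = updFin-other (φ s) j _ j' (j'≢j ∘ sym)
    α-other : ∀ {j'} → j' ≢ j → α s₁ j' ≡ α s j'
    α-other {j'} j'≢j = updFin-other (α s) j _ j' (j'≢j ∘ sym)
    inU-other : ∀ {j'} → j' ≢ j → inU s₁ j' ≡ inU s j'
    inU-other {j'} j'≢j = updFin-other (inU s) j _ j' (j'≢j ∘ sym)
    p-other : ∀ {j'} → j' ≢ j → p s₁ j' ≡ p s j'
    p-other {j'} j'≢j = updFin-other (p s) j _ j' (j'≢j ∘ sym)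

    φ-j : φ s₁ j ≡ updℕ (φ s j) (p s j) (just i)
    φ-j = updFin-same (φ s) j _
    α-j : α s₁ j ≡ updℕ (α s j) (p s j) (t s)
    α-j = updFin-same (α s) j _

    portDual-new : portDual s₁ j (p s j) ≡ t s
    portDual-new rewrite φ-j | α-j | updℕ-same (φ s j) (p s j) (just i) = updℕ-same (α s j) (p s j) (t s)

    portDual-old : ∀ q → q ≢ p s j → portDual s₁ j q ≡ portDual s j q
    portDual-old q q≢p rewrite φ-j | α-j
      | updℕ-other (φ s j) (p s j) (just i) q (q≢p ∘ sym) | updℕ-other (α s j) (p s j) (t s) q (q≢p ∘ sym) = refl

    data Outcome : Set where
      finished : inU s₁ j ≡ false → α s₁ j (r j) ≡ t s → Outcome
      advanced : p s j ≢ r j → inU s₁ j ≡ inU s j → p s₁ j ≡ suc (p s j) → Outcome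

    outcome : Outcome
    outcome = decide (p s j ℕ.≟ r j)
      where
      decide : Dec (p s j ≡ r j) → Outcome
      decide (yes p≡r) = finished (trans (updFin-same (inU s) j _) (if-yes (p s j ℕ.≟ r j) p≡r))
        (subst (λ v → α s₁ j v ≡ t s) p≡r (trans (cong (λ g → g (p s j)) α-j) (updℕ-same (α s j) (p s j) (t s))))
      decide (no p≢r) = advanced p≢r (trans (updFin-same (inU s) j _) (if-no (p s j ℕ.≟ r j) p≢r))
                                     (trans (updFin-same (p s) j _) (if-no (p s j ℕ.≟ r j) p≢r))

    module _ (inU-j : inU s j ≡ true) (I : ClientInv s j) where
      private
        1≤p   = proj₁ (nextPort I inU-j)
        p≤r   = proj₂ (nextPort I inU-j)
        p-free : φ s j (p s j) ≡ nothing
        p-free = freePorts I inU-j (p s j) ℕP.≤-refl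

      load-connect : ∀ i' → 0 ℕ.+ load s₁ i' j ≡ assignedTo (just i) i' ℕ.+ load s i' j
      load-connect i' = trans (cong (λ v → assignedTo v i' ℕ.+ load s₁ i' j) (sym p-free))
                              (load-update {s} {s₁} (just i) φ-j 1≤p p≤r i')

      dualPaid-connect : dualPaid s₁ ≡ dualPaid s + t s
      dualPaid-connect = sum-shift _ _ j (t s) other-clients client-j
        where
        open ≡-Reasoning
        other-clients : ∀ j' → j' ≢ j → portSum (portDual s₁ j') (r j') ≡ portSum (portDual s j') (r j')
        other-clients j' j'≢j =
          cong₂ (λ g h → portSum (λ q → paid (g q) (h q)) (r j')) (φ-other j'≢j) (α-other j'≢j)
        client-j : portSum (portDual s₁ j) (r j) ≡ portSum (portDual s j) (r j) + t s
        client-j = begin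
          portSum (portDual s₁ j) (r j)                           ≡⟨ sym (ℚP.+-identityˡ _) ⟩
          0ℚ + portSum (portDual s₁ j) (r j)                      ≡⟨ cong (λ v → paid v (α s j (p s j)) + portSum (portDual s₁ j) (r j)) (sym p-free) ⟩
          portDual s j (p s j) + portSum (portDual s₁ j) (r j)    ≡⟨ portSum-update (r j) _ _ 1≤p p≤r portDual-old ⟩
          portDual s₁ j (p s j) + portSum (portDual s j) (r j)    ≡⟨ cong (_+ portSum (portDual s j) (r j)) portDual-new ⟩
          t s + portSum (portDual s j) (r j)                      ≡⟨ ℚP.+-comm (t s) _ ⟩
          portSum (portDual s j) (r j) + t s                      ∎

      -- Connecting gains t - c_ij: the port pays t, the connection costs c_ij.
      surplus-connect : surplus s₁ ≡ surplus s + (t s - c i j)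
      surplus-connect = begin
        dualPaid s₁ - (openingCost s + connectionCost s₁)
          ≡⟨ cong₂ (λ D X → D - (openingCost s + X)) dualPaid-connect (cost-bump c (x s) i j) ⟩
        (dualPaid s + t s) - (openingCost s + (connectionCost s + c i j))
          ≡⟨ solve 5 (λ D T Y X C → (D :+ T) :- (Y :+ (X :+ C)) := (D :- (Y :+ X)) :+ (T :- C)) refl
                   (dualPaid s) (t s) (openingCost s) (connectionCost s) (c i j) ⟩
        surplus s + (t s - c i j) ∎
        where open ≡-Reasoning

      clientInv-connect : ClientInv s₁ j
      clientInv-connect = record
        { dual≤time  = dual≤time'
        ; nextPort   = nextPort'
        ; freePorts  = freePorts'
        ; dual≤final = dual≤final'
        ; load≤x     = λ i' → bound-transfer (load-connect i') (bump-column (x s) i j i') (load≤x I i')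
        }
        where
        dual≤time' : ∀ q → portDual s₁ j q ≤ t s
        dual≤time' q with q ℕ.≟ p s j
        ... | yes refl = ℚP.≤-reflexive portDual-new
        ... | no  q≢p  = subst (_≤ t s) (sym (portDual-old q q≢p)) (dual≤time I q)

        nextPort' : inU s₁ j ≡ true → 1 ℕ.≤ p s₁ j × p s₁ j ℕ.≤ r j
        nextPort' e with outcome
        ... | finished cleared _     = flag-clash e cleared
        ... | advanced p≢r _ next rewrite next = s≤s z≤n , ℕP.≤∧≢⇒< p≤r p≢r

        freePorts' : inU s₁ j ≡ true → ∀ q → p s₁ j ℕ.≤ q → φ s₁ j q ≡ nothing
        freePorts' e q p₁≤q with outcome
        ... | finished cleared _    = flag-clash e cleared
        ... | advanced p≢r _ next = trans (cong (λ g → g q) φ-j)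
              (trans (updℕ-other (φ s j) (p s j) (just i) q (ℕP.<⇒≢ p<q))
                     (freePorts I inU-j q (ℕP.<⇒≤ p<q)))
          where
          p<q : p s j ℕ.< q
          p<q = subst (ℕ._≤ q) next p₁≤q

        dual≤final' : inU s₁ j ≡ false → ∀ (q : Fin (r j)) → portDual s₁ j (port q) ≤ α s₁ j (r j)
        dual≤final' e q with outcome
        ... | finished _ αr≡t     = subst (portDual s₁ j (port q) ≤_) (sym αr≡t) (dual≤time' (port q))
        ... | advanced _ same _   = flag-clash (trans same inU-j) e

    inv-connect : inU s j ≡ true → Inv s → Inv s₁
    inv-connect inU-j I j' with j' ≟ᶠ j
    ... | yes refl = clientInv-connect inU-j (I j)
    ... | no  j'≢j = transport ℚP.≤-refl (φ-other j'≢j) (α-other j'≢j) (inU-other j'≢j) (p-other j'≢j)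
                               (λ i' → bump-off-column (x s) i j j'≢j) (I j')

  module Relocation (i : Fin m) (j : Fin n) (q : ℕ) (k : Fin m) (s : State)
                    (R : Reassignable s i j) (A : Attains s j q k) where
    s₁ : State
    s₁ = move i j q k s

    private
      1≤q = proj₁ A
      q≤r = proj₁ (proj₂ A)
      at-k : φ s j q ≡ just k
      at-k = proj₁ (proj₂ (proj₂ A))

    c-k : c k j ≡ M s j
    c-k = proj₂ (proj₂ (proj₂ A))

    φ-other : ∀ {j'} → j' ≢ j → φ s₁ j' ≡ φ s j'
    φ-other {j'} j'≢j = updFin-other (φ s) j _ j' (j'≢j ∘ sym)

    φ-j : φ s₁ j ≡ updℕ (φ s j) q (just i)
    φ-j = updFin-same (φ s) j _

    x-other : ∀ {i' j'} → j' ≢ j → x s₁ i' j' ≡ x s i' j'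
    x-other {j' = j'} j'≢j = if-no (j' ≟ᶠ j) j'≢j

    -- The dual value of every port is unchanged: the moved port stays connected.
    portDual-same : ∀ j' q' → portDual s₁ j' q' ≡ portDual s j' q'
    portDual-same j' q' with j' ≟ᶠ j
    ... | no  j'≢j = cong (λ g → paid (g q') (α s j' q')) (φ-other j'≢j)
    ... | yes refl with q' ℕ.≟ q
    ...   | yes refl rewrite φ-j | updℕ-same (φ s j) q (just i) | at-k = refl
    ...   | no  q'≢q rewrite φ-j | updℕ-other (φ s j) q (just i) q' (q'≢q ∘ sym) = refl

    load-move : ∀ i' → assignedTo (just k) i' ℕ.+ load s₁ i' j ≡ assignedTo (just i) i' ℕ.+ load s i' j
    load-move i' = trans (cong (λ v → assignedTo v i' ℕ.+ load s₁ i' j) (sym at-k))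
                         (load-update {s} {s₁} (just i) φ-j 1≤q q≤r i')

    module _ (I : ClientInv s j) where
      -- Site k serves the moved port, so x_kj ≥ 1 and the decrement is real.
      k-serves : 1 ℕ.≤ x s k j
      k-serves = ℕP.≤-trans (ℕP.≤-reflexive (sym (trans (cong (λ v → assignedTo v k) at-k) (assignedTo-same k))))
                   (ℕP.≤-trans (portSum-term (r j) (λ q' → assignedTo (φ s j q') k) 1≤q q≤r) (load≤x I k))

      x-column : ∀ i' → assignedTo (just k) i' ℕ.+ x s₁ i' j ≡ assignedTo (just i) i' ℕ.+ x s i' j
      x-column i' = begin
        assignedTo (just k) i' ℕ.+ x s₁ i' j
          ≡⟨ cong (assignedTo (just k) i' ℕ.+_) (if-yes (j ≟ᶠ j) refl) ⟩
        assignedTo (just k) i' ℕ.+ ((if ⌊ i' ≟ᶠ i ⌋ then suc (x s i' j) else x s i' j) ℕ.∸ assignedTo (just k) i')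
          ≡⟨ cong (λ v → assignedTo (just k) i' ℕ.+ (v ℕ.∸ assignedTo (just k) i')) (if-suc ⌊ i' ≟ᶠ i ⌋ (x s i' j)) ⟩
        assignedTo (just k) i' ℕ.+ ((assignedTo (just i) i' ℕ.+ x s i' j) ℕ.∸ assignedTo (just k) i')
          ≡⟨ ℕP.m+[n∸m]≡n removable ⟩
        assignedTo (just i) i' ℕ.+ x s i' j ∎
        where
        open ≡-Reasoning
        removable : assignedTo (just k) i' ℕ.≤ assignedTo (just i) i' ℕ.+ x s i' j
        removable with i' ≟ᶠ k
        ... | yes refl = ℕP.≤-trans k-serves (ℕP.m≤n+m (x s k j) _)
        ... | no  _    = z≤n

      connectionCost-move : connectionCost s₁ + c k j ≡ connectionCost s + c i j
      connectionCost-move = begin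
        cost c (x s₁) + c k j          ≡⟨ sym (cost-bump c (x s₁) k j) ⟩
        cost c (bump (x s₁) k j)       ≡⟨ cost-cong c same-after-bump ⟩
        cost c (bump (x s) i j)        ≡⟨ cost-bump c (x s) i j ⟩
        cost c (x s) + c i j           ∎
        where
        open ≡-Reasoning
        same-after-bump : ∀ a b → bump (x s₁) k j a b ≡ bump (x s) i j a b
        same-after-bump a b with b ≟ᶠ j
        ... | yes refl = trans (bump-column (x s₁) k j a) (trans (x-column a) (sym (bump-column (x s) i j a)))
        ... | no  b≢j  = trans (bump-off-column (x s₁) k j b≢j)
                           (trans (x-other b≢j) (sym (bump-off-column (x s) i j b≢j)))

      surplus-move : surplus s₁ ≡ surplus s + (c k j - c i j)
      surplus-move = begin
        dualPaid s₁ - (openingCost s + connectionCost s₁)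
          ≡⟨ cong₂ (λ D X → D - (openingCost s + X)) dualPaid-same cost-after ⟩
        dualPaid s - (openingCost s + ((connectionCost s + c i j) - c k j))
          ≡⟨ solve 5 (λ D Y X Ci Ck → D :- (Y :+ ((X :+ Ci) :- Ck)) := (D :- (Y :+ X)) :+ (Ck :- Ci)) refl
                   (dualPaid s) (openingCost s) (connectionCost s) (c i j) (c k j) ⟩
        surplus s + (c k j - c i j) ∎
        where
        open ≡-Reasoning
        dualPaid-same : dualPaid s₁ ≡ dualPaid s
        dualPaid-same = sum-cong-≗ λ j' → sum-cong-≗ {r j'} λ q' → portDual-same j' (port q')
        cost-after : connectionCost s₁ ≡ (connectionCost s + c i j) - c k j
        cost-after = trans (solve 2 (λ X C → X := (X :+ C) :- C) refl (connectionCost s₁) (c k j))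
                           (cong (_- c k j) connectionCost-move)

      clientInv-move : ClientInv s₁ j
      clientInv-move = record
        { dual≤time  = λ q' → subst (_≤ t s) (sym (portDual-same j q')) (dual≤time I q')
        ; nextPort   = nextPort I
        ; freePorts  = λ e → flag-clash e (proj₁ R)
        ; dual≤final = λ e q' → subst (_≤ α s j (r j)) (sym (portDual-same j (port q'))) (dual≤final I e q')
        ; load≤x     = λ i' → bound-transfer (load-move i') (x-column i') (load≤x I i')
        }

    inv-move : Inv s → Inv s₁
    inv-move I j' with j' ≟ᶠ j
    ... | yes refl = clientInv-move (I j)
    ... | no  j'≢j = transport ℚP.≤-refl (φ-other j'≢j) refl refl refl (λ i' → x-other j'≢j) (I j')

  uContrib : Fin m → State → Fin n → ℚ
  uContrib i s j = if inU s j then 0ℚ ⊔ (t s - c i j) else 0ℚ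

  vContrib : Fin m → State → Fin n → ℚ
  vContrib i s j = if inU s j then 0ℚ else 0ℚ ⊔ (M s j - c i j)

  bid-split : ∀ i s → bid s i ≡ Σℚ n (uContrib i s) + Σℚ n (vContrib i s)
  bid-split i s = trans (listSum-cong (All.universal (λ j → if-split (inU s j) _ _) (allFin n)))
                        (listSum-+ (allFin n) (uContrib i s) (vContrib i s))

  surplus-open : ∀ i s → surplus (openAt i s) ≡ surplus s - f i
  surplus-open i s = begin
    dualPaid s - (openingCost (openAt i s) + connectionCost s)
      ≡⟨ cong (λ Y → dualPaid s - (Y + connectionCost s))
              (weighted-suc f (y s) (y (openAt i s)) i (λ i' i'≢i → updFin-other (y s) i _ i' (i'≢i ∘ sym))
                            (updFin-same (y s) i _)) ⟩
    dualPaid s - ((openingCost s + f i) + connectionCost s)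
      ≡⟨ solve 4 (λ D Y F X → D :- ((Y :+ F) :+ X) := (D :- (Y :+ X)) :- F) refl
               (dualPaid s) (openingCost s) (f i) (connectionCost s) ⟩
    surplus s - f i ∎
    where open ≡-Reasoning

  inv-open : ∀ {s} i → Inv s → Inv (openAt i s)
  inv-open i I j = transport ℚP.≤-refl refl refl refl refl (λ _ → refl) (I j)

  M-cong : ∀ {s s' j} → φ s' j ≡ φ s j → M s' j ≡ M s j
  M-cong {j = j} e = cong (λ g → maxℚ (map (λ q → maybe (λ i → c i j) 0ℚ (g q)) (ports (r j)))) e

  module Reassignment (i : Fin m) where
    reassign-frame : ∀ {L s s'} → Reassign i L s s' → inU s' ≡ inU s × t s' ≡ t s
    reassign-frame done              = refl , refl
    reassign-frame (skip _ rest)     = reassign-frame rest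
    reassign-frame (mv _ _ _ _ rest) = reassign-frame rest

    reassign-inv : ∀ {L s s'} → Inv s → Reassign i L s s' → Inv s'
    reassign-inv I done              = I
    reassign-inv I (skip _ rest)     = reassign-inv I rest
    reassign-inv I (mv q k R A rest) = reassign-inv (Relocation.inv-move i _ q k _ R A I) rest

    -- Each reassigned client j earns M_j - c_ij, which is its reassignment offer;
    -- the other clients offer nothing.
    reassign-surplus : ∀ {L s s'} → Unique L → Inv s → Reassign i L s s' →
                       surplus s' ≡ surplus s + listSum L (vContrib i s)
    reassign-surplus _ I done = sym (ℚP.+-identityʳ _)
    reassign-surplus {j ∷ js} {s} {s'} (_ ∷ u) I (skip not-R rest) = begin
      surplus s'                                       ≡⟨ reassign-surplus u I rest ⟩
      surplus s + listSum js (vContrib i s)            ≡⟨ cong (λ v → surplus s + v) (sym (ℚP.+-identityˡ _)) ⟩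
      surplus s + (0ℚ + listSum js (vContrib i s))     ≡⟨ cong (λ v → surplus s + (v + listSum js (vContrib i s))) (sym no-offer) ⟩
      surplus s + listSum (j ∷ js) (vContrib i s)      ∎
      where
      open ≡-Reasoning
      no-offer : vContrib i s j ≡ 0ℚ
      no-offer with inU s j
      ... | true  = refl
      ... | false = posPart-≤ (ℚP.≮⇒≥ λ lt → not-R (refl , lt))
    reassign-surplus {j ∷ js} {s} {s'} (j∉js ∷ u) I (mv q k R A rest) = begin
      surplus s'                                                ≡⟨ reassign-surplus u (inv-move I) rest ⟩
      surplus s₁ + listSum js (vContrib i s₁)                   ≡⟨ cong₂ _+_ (surplus-move (I j)) others-same ⟩
      (surplus s + (c k j - c i j)) + listSum js (vContrib i s) ≡⟨ ℚP.+-assoc (surplus s) _ _ ⟩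
      surplus s + ((c k j - c i j) + listSum js (vContrib i s)) ≡⟨ cong (λ v → surplus s + (v + listSum js (vContrib i s))) (sym offer) ⟩
      surplus s + listSum (j ∷ js) (vContrib i s)               ∎
      where
      open ≡-Reasoning
      open Relocation i j q k s R A
      others-same : listSum js (vContrib i s₁) ≡ listSum js (vContrib i s)
      others-same = listSum-cong (All.map (λ {j'} j≢j' → cong (λ v → if inU s j' then 0ℚ else 0ℚ ⊔ (v - c i j'))
                                                              (M-cong {s} {s₁} (φ-other (j≢j' ∘ sym)))) j∉js)
      offer : vContrib i s j ≡ c k j - c i j
      offer = trans (cong (λ b → if b then 0ℚ else 0ℚ ⊔ (M s j - c i j)) (proj₁ R))
                    (trans (posPart-≥ (ℚP.<⇒≤ (proj₂ R))) (cong (_- c i j) (sym c-k)))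

  module Connecting (i : Fin m) where
    connectStep : Fin n → State → State
    connectStep j s = if inU s j ∧ ⌊ c i j ≤? t s ⌋ then action1 i j s else s

    connectStep-inv : ∀ j s → Inv s → Inv (connectStep j s)
    connectStep-inv j s I with inU s j in inU-j | c i j ≤? t s
    ... | true  | yes _ = Connection.inv-connect i j s inU-j I
    ... | true  | no  _ = I
    ... | false | _     = I

    connectStep-surplus : ∀ j s → Inv s → surplus (connectStep j s) ≡ surplus s + uContrib i s j
    connectStep-surplus j s I with inU s j in inU-j | c i j ≤? t s
    ... | true  | yes c≤t = trans (Connection.surplus-connect i j s inU-j (I j))
                                  (cong (surplus s +_) (sym (posPart-≥ c≤t)))
    ... | true  | no  c≰t = sym (trans (cong (surplus s +_) (posPart-≤ (ℚP.<⇒≤ (ℚP.≰⇒> c≰t))))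
                                       (ℚP.+-identityʳ _))
    ... | false | _       = sym (ℚP.+-identityʳ _)

    connectStep-frame : ∀ j s {j'} → j' ≢ j → uContrib i (connectStep j s) j' ≡ uContrib i s j'
    connectStep-frame j s {j'} j'≢j with inU s j | c i j ≤? t s
    ... | true  | yes _ = cong (λ b → if b then 0ℚ ⊔ (t s - c i j') else 0ℚ) (Connection.inU-other i j s j'≢j)
    ... | true  | no  _ = refl
    ... | false | _     = refl

    connect-inv : ∀ L s → Inv s → Inv (connectAll i L s)
    connect-inv []       s I = I
    connect-inv (j ∷ js) s I = connect-inv js (connectStep j s) (connectStep-inv j s I)

    connect-surplus : ∀ {L} s → Unique L → Inv s →
                      surplus (connectAll i L s) ≡ surplus s + listSum L (uContrib i s)
    connect-surplus {[]}     s _           I = sym (ℚP.+-identityʳ _)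
    connect-surplus {j ∷ js} s (j∉js ∷ u) I = begin
      surplus (connectAll i js s₁)                             ≡⟨ connect-surplus s₁ u (connectStep-inv j s I) ⟩
      surplus s₁ + listSum js (uContrib i s₁)                  ≡⟨ cong₂ _+_ (connectStep-surplus j s I) others-same ⟩
      (surplus s + uContrib i s j) + listSum js (uContrib i s) ≡⟨ ℚP.+-assoc (surplus s) _ _ ⟩
      surplus s + listSum (j ∷ js) (uContrib i s)              ∎
      where
      open ≡-Reasoning
      s₁ = connectStep j s
      others-same : listSum js (uContrib i s₁) ≡ listSum js (uContrib i s)
      others-same = listSum-cong (All.map (λ j≢j' → connectStep-frame j s (j≢j' ∘ sym)) j∉js)

  open Reassignment
  open Connecting

  -- Event 2 is paid for exactly: opening costs f_i, which is the bid; the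
  -- reassignments earn its second part and the new connections its first part.
  surplus-event2 : ∀ {s s'} i → Inv s → Event2 s i → Reassign i (allFin n) (openAt i s) s' →
                   surplus (connectAll i (allFin n) s') ≡ surplus s
  surplus-event2 {s} {s'} i I bid≡f re = begin
    surplus (connectAll i (allFin n) s')      ≡⟨ connect-surplus i s' (allFin⁺ n) (reassign-inv i (inv-open i I) re) ⟩
    surplus s' + Σℚ n (uContrib i s')         ≡⟨ cong₂ _+_ (reassign-surplus i (allFin⁺ n) (inv-open i I) re) first-part-same ⟩
    (surplus (openAt i s) + V) + U            ≡⟨ cong (λ S → (S + V) + U) (surplus-open i s) ⟩
    ((surplus s - f i) + V) + U               ≡⟨ cong (λ F → ((surplus s - F) + V) + U) (trans (sym bid≡f) (bid-split i s)) ⟩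
    ((surplus s - (U + V)) + V) + U           ≡⟨ solve 3 (λ S U V → ((S :- (U :+ V)) :+ V) :+ U := S) refl (surplus s) U V ⟩
    surplus s                                 ∎
    where
    open ≡-Reasoning
    U = Σℚ n (uContrib i s)
    V = Σℚ n (vContrib i s)
    first-part-same : Σℚ n (uContrib i s') ≡ U
    first-part-same = cong₂ (λ inU' t' → Σℚ n (λ j → if inU' j then 0ℚ ⊔ (t' - c i j) else 0ℚ))
                            (proj₁ (reassign-frame i re)) (proj₂ (reassign-frame i re))

  step-inv : ∀ {s s'} → Step s s' → Inv s → Inv s'
  step-inv (ev1 i j _ (inU-j , _ , _)) I = Connection.inv-connect i j _ inU-j I
  step-inv (ev2 i _ _ re)              I = connect-inv i (allFin n) _ (reassign-inv i (inv-open i I) re)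
  step-inv (tick _ _ t<t' _)           I = λ j → transport (ℚP.<⇒≤ t<t') refl refl refl refl (λ _ → refl) (I j)

  step-surplus : ∀ {s s'} → Step s s' → Inv s → surplus s' ≡ surplus s
  step-surplus {s} (ev1 i j _ (inU-j , t≡c , _)) I = begin
    surplus (action1 i j s)        ≡⟨ Connection.surplus-connect i j s inU-j (I j) ⟩
    surplus s + (t s - c i j)      ≡⟨ cong (λ v → surplus s + (v - c i j)) t≡c ⟩
    surplus s + (c i j - c i j)    ≡⟨ cong (surplus s +_) (ℚP.+-inverseʳ (c i j)) ⟩
    surplus s + 0ℚ                 ≡⟨ ℚP.+-identityʳ _ ⟩
    surplus s                      ∎
    where open ≡-Reasoning
  step-surplus (ev2 i _ bid≡f re) I = surplus-event2 i I bid≡f re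
  step-surplus (tick _ _ _ _)     I = refl

  run : ∀ {s s'} → Star Step s s' → Inv s → Inv s' × surplus s' ≡ surplus s
  run ε            I = I , refl
  run (st ◅ steps) I with run steps (step-inv st I)
  ... | I' , e = I' , trans e (step-surplus st I)

  inv-initial : (∀ j → 1 ℕ.≤ r j) → Inv initial
  inv-initial r≥1 j = record
    { dual≤time  = λ _ → ℚP.≤-refl
    ; nextPort   = λ _ → ℕP.≤-refl , r≥1 j
    ; freePorts  = λ _ _ _ → refl
    ; dual≤final = λ ()
    ; load≤x     = λ _ → ℕP.≤-reflexive (Count.sum-replicate-zero (r j))
    }

  surplus-initial : surplus initial ≡ 0ℚ
  surplus-initial = cong₂ (λ D C → D - C) nothing-paid (cong₂ _+_ nothing-opened nothing-connected)
    where
    nothing-paid : dualPaid initial ≡ 0ℚ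
    nothing-paid = trans (sum-cong-≗ λ j → sum-replicate-zero (r j)) (sum-replicate-zero n)
    nothing-opened : openingCost initial ≡ 0ℚ
    nothing-opened = trans (sum-cong-≗ λ i → ℚP.*-zeroʳ (f i)) (sum-replicate-zero m)
    nothing-connected : connectionCost initial ≡ 0ℚ
    nothing-connected = trans (sum-cong-≗ λ i → trans (sum-cong-≗ λ j → ℚP.*-zeroʳ (c i j)) (sum-replicate-zero n))
                              (sum-replicate-zero m)

  balanced : (∀ j → 1 ℕ.≤ r j) → ∀ {s} → Star Step initial s →
             Inv s × openingCost s + connectionCost s ≡ dualPaid s
  balanced r≥1 steps with run steps (inv-initial r≥1)
  ... | I , e = I , sym (x∙y⁻¹≈ε⇒x≈y _ _ (trans e surplus-initial))

  -- Every connected port of a finished client paid at most the client's final dual value.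
  dualPaid≤SOL-D : ∀ s → Inv s → (∀ j → inU s j ≡ false) → dualPaid s ≤ SOL-D s
  dualPaid≤SOL-D s I finished = subst (dualPaid s ≤_) (sym (Σℚ≡sum n _))
    (sum-mono λ j → sum-bound _ (α s j (r j)) (dual≤final (I j) (finished j)))

  primalCost≡costs : ∀ s → primalCost s ≡ openingCost s + connectionCost s
  primalCost≡costs s = cong₂ _+_ (Σℚ≡sum m _)
    (trans (Σℚ≡sum m _) (sum-cong-≗ λ i → Σℚ≡sum n λ j → c i j * ℕ→ℚ (x s i j)))

lemma3 : (m n : ℕ) (f : Fin m → ℚ) (c : Fin m → Fin n → ℚ) (r : Fin n → ℕ) →
         (∀ i → 0ℚ ≤ f i) → (∀ i j → 0ℚ ≤ c i j) → (∀ j → 1 Data.Nat.≤ r j) →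
         (s : PrimalDual.State m n f c r) → PrimalDual.Produced m n f c r s →
         PrimalDual.primalCost m n f c r s ≤ PrimalDual.SOL-D m n f c r s
lemma3 m n f c r _ _ r≥1 s (steps , finished) = begin
  primalCost s                       ≡⟨ primalCost≡costs s ⟩
  openingCost s + connectionCost s   ≡⟨ proj₂ reached ⟩
  dualPaid s                         ≤⟨ dualPaid≤SOL-D s (proj₁ reached) finished ⟩
  SOL-D s                            ∎
  where
  open PrimalDual m n f c r
  open Analysis m n f c r
  open ℚP.≤-Reasoning
  reached : Inv s × openingCost s + connectionCost s ≡ dualPaid s
  reached = balanced r≥1 steps
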